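{- Let $t$ be a positive integer and $v_1<v_2<\cdots<v_{t+1}$ positive integers. A PDIMOA$^*(\prod_{i=2}^{t+1} v_i;t,t+1,(v_1,v_2,\dots,v_t,v_{t+1}))$ exists if and only if $v_1\mid v_i$ for all $2\le i\le t+1$.
   Context: A mixed orthogonal array MOA$(N;t,k,(v_1,\dots,v_k))$ is an $N\times k$ array whose $j$-th column has entries from a set $V_j$ with $|V_j|=v_j$, such that for every set $S$ of $t$ columns, each $t$-tuple in $\prod_{j\in S}V_j$ occurs as a row of the $N\times t$ subarray on $S$ the same number $\lambda_S$ of times ($\lambda_S=N/\prod_{j\in S}v_j$ is the index of $S$). It is a pairwise distinct index MOA, PDIMOA$(N;t,k,(v_1,\dots,v_k))$, if the $\binom{k}{t}$ indices $\lambda_S$ are pairwise distinct; it is a PDIMOA$^*$ if moreover $\lambda_S=1$ for some $S$. -}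

module Defs where

open import Data.Nat using (ℕ; zero; suc; _*_)
open import Data.Fin using (Fin; zero; suc)
open import Data.Fin.Properties using (all?; _≟_)
open import Data.Fin.Subset using (Subset; _∈_; ∣_∣)
open import Data.Fin.Subset.Properties using (_∈?_)
open import Data.List using (List; filter; length; allFin)
open import Data.Product using (Σ; ∃; _×_)
open import Relation.Nullary using (¬_)
open import Relation.Nullary.Decidable using (_→-dec_)
open import Relation.Binary.PropositionalEquality using (_≡_)

∏ : (n : ℕ) → (Fin n → ℕ) → ℕ
∏ zero    f = 1
∏ (suc n) f = f zero * ∏ n (λ i → f (suc i))

Array : (N k : ℕ) → (v : Fin k → ℕ) → Set
Array N k v = Fin N → (j : Fin k) → Fin (v j)

-- A full row / tuple with j-th entry in Fin (v j); its restriction to a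
-- column set S is the S-tuple it represents.
Tuple : (k : ℕ) → (v : Fin k → ℕ) → Set
Tuple k v = (j : Fin k) → Fin (v j)

Agrees : ∀ {N k v} → Array N k v → Subset k → Tuple k v → Fin N → Set
Agrees A S x r = ∀ j → j ∈ S → A r j ≡ x j

occurrences : ∀ {N k v} → Array N k v → Subset k → Tuple k v → ℕ
occurrences {N} A S x =
  length (filter (λ r → all? (λ j → (j ∈? S) →-dec (A r j ≟ x j))) (allFin N))

IsMOAWithIndex : (N t k : ℕ) (v : Fin k → ℕ) → Array N k v → (Subset k → ℕ) → Set
IsMOAWithIndex N t k v A λS =
  ∀ (S : Subset k) → ∣ S ∣ ≡ t → ∀ (x : Tuple k v) → occurrences A S x ≡ λS S

IsPDIMOA : (N t k : ℕ) (v : Fin k → ℕ) → Array N k v → (Subset k → ℕ) → Set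
IsPDIMOA N t k v A λS =
  IsMOAWithIndex N t k v A λS ×
  (∀ (S S′ : Subset k) → ∣ S ∣ ≡ t → ∣ S′ ∣ ≡ t → ¬ S ≡ S′ → ¬ λS S ≡ λS S′)

IsPDIMOA* : (N t k : ℕ) (v : Fin k → ℕ) → Array N k v → (Subset k → ℕ) → Set
IsPDIMOA* N t k v A λS =
  IsPDIMOA N t k v A λS × ∃ (λ S → ∣ S ∣ ≡ t × λS S ≡ 1)

PDIMOA*-exists : (N t k : ℕ) (v : Fin k → ℕ) → Set
PDIMOA*-exists N t k v =
  Σ (Array N k v) λ A → Σ (Subset k → ℕ) λ λS → IsPDIMOA* N t k v A λS

-- The t-subsets of the t + 1 columns are the sets ⊤ - j omitting a single column j.
-- Counting in two ways the rows that agree with a fixed tuple off two columns i ≠ j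
-- gives v i * λ (⊤ - j) ≡ v j * λ (⊤ - i). So if λ (⊤ - j) ≡ 1 then v j divides every
-- v i; as v zero is the smallest level, j is zero and v zero divides every v (suc i).
-- Conversely, if v zero divides every v (suc i), take one row for each choice of the
-- entries in the last t columns and put their sum mod v zero into column zero. A tuple
-- then occurs once off column zero, and off column suc i exactly as often as there are
-- c < v (suc i) with c + s ≡ x (mod v zero) for fixed s and x, namely v (suc i) / v zero.
-- These indices v j / v zero are pairwise distinct because the v j are.

module Submission where

open import Defs
open import Data.Nat using (ℕ; zero; suc; _<_)
open import Data.Nat.Divisibility using (_∣_)
open import Data.Fin using (Fin; zero; suc) renaming (_<_ to _<ᶠ_)
open import Function.Bundles using (_⇔_)

open import Data.Nat using (_+_; _*_; z<s; NonZero; >-nonZero; _%_)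
open import Data.Nat.Properties
  using (+-0-commutativeMonoid; +-commutativeSemigroup; +-assoc; +-comm; +-cancelˡ-≡; +-identityʳ; +-suc;
         *-identityʳ; <⇒≢; <⇒≱)
open import Data.Nat.DivMod using (_/_; _mod_; [m+n]%n≡m%n; m<n⇒m%n≡m; m*n/n≡m; n/n≡1; /-cancelʳ-≡; m%n<n)
open import Data.Nat.Divisibility using (divides-refl; ∣-refl; m∣m*n; ∣⇒≤)
open import Data.Fin using (toℕ; fromℕ<; _↑ˡ_; _↑ʳ_; combine; remQuot; fromℕ; inject₁)
open import Data.Fin.Properties
  using (all?; _≟_; <-cmp; suc-injective; toℕ-injective; toℕ-fromℕ<; toℕ-↑ˡ; toℕ-↑ʳ; toℕ-inject₁; toℕ-fromℕ;
         toℕ<n; punchInᵢ≢i; remQuot-combine)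
open import Data.Fin.Subset using (Subset; _∈_; _∉_; ∣_∣; ⊤; _-_; outside; inside)
open import Data.Fin.Subset.Properties
  using (_∈?_; ∈⊤; ∣⊤∣≡n; ∣p∣≡n⇒p≡⊤; p─⊥≡p; p─q⊆p; x∈p∧x≢y⇒x∈p-y; p─q─r≡p─r─q)
open import Data.List using (filter; length; tabulate)
open import Data.Product using (∃; _×_; _,_; proj₁; proj₂)
open import Data.Empty using (⊥-elim)
open import Data.Vec.Base using (_∷_; there)
open import Data.Vec.Functional using (removeAt; replicate)
open import Function using (_∘_; id; mk⇔; case_of_; Equivalence)
open import Level using (0ℓ)
open import Relation.Binary.Definitions using (tri<; tri≈; tri>)
open import Relation.Binary.PropositionalEquality
open import Relation.Nullary using (¬_; Dec; yes; no; contradiction)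
open import Relation.Nullary.Decidable using (_→-dec_)
open import Relation.Unary using (Pred; Decidable)
open import Algebra.Properties.CommutativeMonoid.Sum +-0-commutativeMonoid
  using (sum; sum-syntax; sum-remove; sum-replicate-zero; sum-init-last; sum-cong-≗; ∑-comm)
open import Algebra.Properties.CommutativeSemigroup +-commutativeSemigroup using (x∙yz≈y∙xz)
import Data.Nat as ℕ

𝟙 : ∀ {p} {P : Set p} → Dec P → ℕ
𝟙 (yes _) = 1
𝟙 (no _)  = 0

𝟙-yes : ∀ {p} {P : Set p} (P? : Dec P) → P → 𝟙 P? ≡ 1
𝟙-yes (yes _) _ = refl
𝟙-yes (no ¬p) p = contradiction p ¬p

𝟙-no : ∀ {p} {P : Set p} (P? : Dec P) → ¬ P → 𝟙 P? ≡ 0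
𝟙-no (yes p) ¬p = contradiction p ¬p
𝟙-no (no _)  _  = refl

𝟙-cong : ∀ {p q} {P : Set p} {Q : Set q} (P? : Dec P) (Q? : Dec Q) → P ⇔ Q → 𝟙 P? ≡ 𝟙 Q?
𝟙-cong (yes p) Q? P⇔Q = sym (𝟙-yes Q? (Equivalence.to P⇔Q p))
𝟙-cong (no ¬p) Q? P⇔Q = sym (𝟙-no Q? (¬p ∘ Equivalence.from P⇔Q))

count : ∀ {n p} {P : Pred (Fin n) p} → Decidable P → ℕ
count {n} P? = ∑[ i < n ] 𝟙 (P? i)

length-filter-tabulate : ∀ {a p} {A : Set a} {P : Pred A p} (P? : Decidable P) n (g : Fin n → A) →
  length (filter P? (tabulate g)) ≡ ∑[ i < n ] 𝟙 (P? (g i))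
length-filter-tabulate P? zero    g = refl
length-filter-tabulate P? (suc n) g with P? (g zero)
... | yes _ = cong suc (length-filter-tabulate P? n (g ∘ suc))
... | no _  = length-filter-tabulate P? n (g ∘ suc)

∑-const : ∀ n c → ∑[ i < n ] c ≡ n * c
∑-const zero    c = refl
∑-const (suc n) c = cong (c +_) (∑-const n c)

∑-point : ∀ {n} (f : Fin n → ℕ) i → (∀ j → j ≢ i → f j ≡ 0) → ∑[ j < n ] f j ≡ f i
∑-point {suc n} f i off = begin
  sum f                      ≡⟨ sum-remove {i = i} f ⟩
  f i + sum (removeAt f i)   ≡⟨ cong (f i +_) (sum-cong-≗ (λ j → off _ (punchInᵢ≢i i j))) ⟩
  f i + sum (replicate n 0)  ≡⟨ cong (f i +_) (sum-replicate-zero n) ⟩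
  f i + 0                    ≡⟨ +-identityʳ (f i) ⟩
  f i                        ∎
  where open ≡-Reasoning

∑-↑ : ∀ m n (f : Fin (m + n) → ℕ) →
      ∑[ i < m + n ] f i ≡ ∑[ i < m ] f (i ↑ˡ n) + ∑[ j < n ] f (m ↑ʳ j)
∑-↑ zero    n f = refl
∑-↑ (suc m) n f = trans (cong (f zero +_) (∑-↑ m n (f ∘ suc))) (sym (+-assoc (f zero) _ _))

∑-combine : ∀ m n (f : Fin (m * n) → ℕ) →
            ∑[ i < m * n ] f i ≡ ∑[ i < m ] ∑[ j < n ] f (combine i j)
∑-combine zero    n f = refl
∑-combine (suc m) n f =
  trans (∑-↑ n (m * n) f) (cong (∑[ j < n ] f (j ↑ˡ m * n) +_) (∑-combine m n (f ∘ (n ↑ʳ_))))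

Periodic : ℕ → (ℕ → ℕ) → Set
Periodic d g = ∀ k → g (d + k) ≡ g k

∑-periodic : ∀ d {g} → Periodic d g → ∀ m →
             ∑[ c < m * d ] g (toℕ c) ≡ m * ∑[ j < d ] g (toℕ j)
∑-periodic d {g} per zero    = refl
∑-periodic d {g} per (suc m) = begin
  ∑[ c < d + m * d ] g (toℕ c)                                      ≡⟨ ∑-↑ d (m * d) _ ⟩
  ∑[ j < d ] g (toℕ (j ↑ˡ m * d)) + ∑[ c < m * d ] g (toℕ (d ↑ʳ c)) ≡⟨ cong₂ _+_
    (sum-cong-≗ {d} λ j → cong g (toℕ-↑ˡ j (m * d)))
    (sum-cong-≗ {m * d} λ c → trans (cong g (toℕ-↑ʳ d c)) (per (toℕ c))) ⟩
  ∑[ j < d ] g (toℕ j) + ∑[ c < m * d ] g (toℕ c)                   ≡⟨ cong (_ +_) (∑-periodic d per m) ⟩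
  ∑[ j < d ] g (toℕ j) + m * ∑[ j < d ] g (toℕ j)                   ∎
  where open ≡-Reasoning

∑-rotate : ∀ d (g : ℕ → ℕ) → g d ≡ g 0 → ∑[ j < d ] g (suc (toℕ j)) ≡ ∑[ j < d ] g (toℕ j)
∑-rotate d g wrap = +-cancelˡ-≡ (g 0) _ _ (begin
  ∑[ j < suc d ] g (toℕ j)                            ≡⟨ sum-init-last (g ∘ toℕ) ⟩
  ∑[ j < d ] g (toℕ (inject₁ j)) + g (toℕ (fromℕ d))  ≡⟨ cong₂ _+_
    (sum-cong-≗ {d} λ j → cong g (toℕ-inject₁ j)) (trans (cong g (toℕ-fromℕ d)) wrap) ⟩
  ∑[ j < d ] g (toℕ j) + g 0                          ≡⟨ +-comm _ (g 0) ⟩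
  g 0 + ∑[ j < d ] g (toℕ j)                          ∎)
  where open ≡-Reasoning

∑-shift : ∀ d {g} → Periodic d g → ∀ s → ∑[ j < d ] g (toℕ j + s) ≡ ∑[ j < d ] g (toℕ j)
∑-shift d {g} per zero    = sum-cong-≗ {d} λ j → cong g (+-identityʳ (toℕ j))
∑-shift d {g} per (suc s) = begin
  ∑[ j < d ] g (toℕ j + suc s)    ≡⟨ sum-cong-≗ {d} (λ j → cong g (+-suc (toℕ j) s)) ⟩
  ∑[ j < d ] g (suc (toℕ j) + s)  ≡⟨ ∑-rotate d (λ k → g (k + s)) (per s) ⟩
  ∑[ j < d ] g (toℕ j + s)        ≡⟨ ∑-shift d per s ⟩
  ∑[ j < d ] g (toℕ j)            ∎
  where open ≡-Reasoning

count-residue : ∀ {n} d .{{_ : NonZero d}} → d ∣ n → ∀ s (x : Fin d) →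
                count (λ (c : Fin n) → (toℕ c + s) % d ℕ.≟ toℕ x) ≡ n / d
count-residue d (divides-refl m) s x = begin
  ∑[ c < m * d ] g (toℕ c + s)  ≡⟨ ∑-periodic d (λ k → trans (cong g (+-assoc d k s)) (per (k + s))) m ⟩
  m * ∑[ j < d ] g (toℕ j + s)  ≡⟨ cong (m *_) (∑-shift d per s) ⟩
  m * ∑[ j < d ] g (toℕ j)      ≡⟨ cong (m *_) one ⟩
  m * 1                         ≡⟨ *-identityʳ m ⟩
  m                             ≡⟨ sym (m*n/n≡m m d) ⟩
  m * d / d                     ∎
  where
  open ≡-Reasoning
  g : ℕ → ℕ
  g k = 𝟙 (k % d ℕ.≟ toℕ x)
  per : Periodic d g
  per k = cong (λ r → 𝟙 (r ℕ.≟ toℕ x)) (trans (cong (_% d) (+-comm d k)) ([m+n]%n≡m%n k d))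
  one : ∑[ j < d ] g (toℕ j) ≡ 1
  one = begin
    ∑[ j < d ] g (toℕ j)              ≡⟨ sum-cong-≗ {d} (λ j →
                                           cong (λ r → 𝟙 (r ℕ.≟ toℕ x)) (m<n⇒m%n≡m (toℕ<n j))) ⟩
    ∑[ j < d ] 𝟙 (toℕ j ℕ.≟ toℕ x)   ≡⟨ ∑-point _ x (λ j j≢x → 𝟙-no _ (j≢x ∘ toℕ-injective)) ⟩
    𝟙 (toℕ x ℕ.≟ toℕ x)              ≡⟨ 𝟙-yes _ refl ⟩
    1                                ∎

-- Inductive rather than a function type, so that digit sequences can be compared
-- with ≡ without function extensionality.
infixr 5 _∷_

data Digits : (t : ℕ) → (Fin t → ℕ) → Set where
  []  : ∀ {f} → Digits zero f
  _∷_ : ∀ {t f} → Fin (f zero) → Digits t (λ i → f (suc i)) → Digits (suc t) f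

head : ∀ {t f} → Digits (suc t) f → Fin (f zero)
head (c ∷ _) = c

tail : ∀ {t f} → Digits (suc t) f → Digits t (λ i → f (suc i))
tail (_ ∷ a) = a

digit : ∀ {t f} → Digits t f → (i : Fin t) → Fin (f i)
digit (c ∷ a) zero    = c
digit (c ∷ a) (suc i) = digit a i

digits : ∀ {t f} → ((i : Fin t) → Fin (f i)) → Digits t f
digits {zero}  g = []
digits {suc t} g = g zero ∷ digits (g ∘ suc)

_[_]≔ᴰ_ : ∀ {t f} → Digits t f → (i : Fin t) → Fin (f i) → Digits t f
(c ∷ a) [ zero  ]≔ᴰ c′ = c′ ∷ a
(c ∷ a) [ suc i ]≔ᴰ c′ = c ∷ a [ i ]≔ᴰ c′

digitSum : ∀ {t f} → Digits t f → ℕ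
digitSum []      = 0
digitSum (c ∷ a) = toℕ c + digitSum a

digit-injective : ∀ {t f} {a b : Digits t f} → (∀ i → digit a i ≡ digit b i) → a ≡ b
digit-injective {a = []}    {[]}    _  = refl
digit-injective {a = _ ∷ _} {_ ∷ _} eq = cong₂ _∷_ (eq zero) (digit-injective (eq ∘ suc))

digit-digits : ∀ {t f} (g : (i : Fin t) → Fin (f i)) i → digit (digits {f = f} g) i ≡ g i
digit-digits         g zero    = refl
digit-digits {f = f} g (suc i) = digit-digits {f = λ i → f (suc i)} (g ∘ suc) i

digit-update-same : ∀ {t f} (a : Digits t f) i c → digit (a [ i ]≔ᴰ c) i ≡ c
digit-update-same (_ ∷ a) zero    c = refl
digit-update-same (_ ∷ a) (suc i) c = digit-update-same a i c

digit-update-other : ∀ {t f} (a : Digits t f) {i j} c → j ≢ i → digit (a [ i ]≔ᴰ c) j ≡ digit a j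
digit-update-other (_ ∷ a) {zero}  {zero}  c j≢i = contradiction refl j≢i
digit-update-other (_ ∷ a) {zero}  {suc j} c _   = refl
digit-update-other (_ ∷ a) {suc i} {zero}  c _   = refl
digit-update-other (_ ∷ a) {suc i} {suc j} c j≢i = digit-update-other a c (j≢i ∘ cong suc)

digitSum-update : ∀ {t f} (a : Digits t f) i → ∃ λ s → ∀ c → digitSum (a [ i ]≔ᴰ c) ≡ toℕ c + s
digitSum-update (c₀ ∷ a) zero    = digitSum a , λ c → refl
digitSum-update (c₀ ∷ a) (suc i) with digitSum-update a i
... | s , eq = toℕ c₀ + s , λ c → trans (cong (toℕ c₀ +_) (eq c)) (x∙yz≈y∙xz (toℕ c₀) (toℕ c) s)

∑ᴰ : ∀ {t f} → (Digits t f → ℕ) → ℕ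
∑ᴰ {zero}      w = w []
∑ᴰ {suc t} {f} w = ∑[ c < f zero ] ∑ᴰ (λ a → w (c ∷ a))

countᴰ : ∀ {t f p} {Q : Pred (Digits t f) p} → Decidable Q → ℕ
countᴰ Q? = ∑ᴰ (λ a → 𝟙 (Q? a))

decode : ∀ {t f} → Fin (∏ t f) → Digits t f
decode {zero}      _ = []
decode {suc t} {f} r with remQuot (∏ t (λ i → f (suc i))) r
... | c , r′ = c ∷ decode r′

∑-decode : ∀ {t f} (w : Digits t f → ℕ) → ∑[ r < ∏ t f ] w (decode r) ≡ ∑ᴰ w
∑-decode {zero}      w = +-identityʳ (w [])
∑-decode {suc t} {f} w = begin
  ∑[ r < f zero * P ] w (decode r)                   ≡⟨ ∑-combine (f zero) P _ ⟩
  ∑[ c < f zero ] ∑[ r < P ] w (decode (combine c r)) ≡⟨ sum-cong-≗ {f zero} (λ c → sum-cong-≗ {P} (λ r →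
    cong (λ (p : _ × _) → w (proj₁ p ∷ decode (proj₂ p))) (remQuot-combine c r))) ⟩
  ∑[ c < f zero ] ∑[ r < P ] w (c ∷ decode r)         ≡⟨ sum-cong-≗ {f zero} (λ c → ∑-decode (λ a → w (c ∷ a))) ⟩
  ∑ᴰ w                                               ∎
  where
  open ≡-Reasoning
  P : ℕ
  P = ∏ t (λ i → f (suc i))

countᴰ-point : ∀ {t f p} {Q : Pred (Digits t f) p} (Q? : Decidable Q) y →
               (∀ a → Q a → a ≡ y) → countᴰ Q? ≡ 𝟙 (Q? y)
countᴰ-point Q? []       only = refl
countᴰ-point {f = f} Q? (y ∷ ys) only = begin
  ∑[ c < f zero ] countᴰ (λ a → Q? (c ∷ a))  ≡⟨ sum-cong-≗ {f zero} (λ c →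
    countᴰ-point (λ a → Q? (c ∷ a)) ys (λ a q → cong tail (only (c ∷ a) q))) ⟩
  ∑[ c < f zero ] 𝟙 (Q? (c ∷ ys))            ≡⟨ ∑-point _ y (λ c c≢y → 𝟙-no _ (c≢y ∘ cong head ∘ only (c ∷ ys))) ⟩
  𝟙 (Q? (y ∷ ys))                            ∎
  where open ≡-Reasoning

countᴰ-line : ∀ {t f p} {Q : Pred (Digits t f) p} (Q? : Decidable Q) y i →
              (∀ a → Q a → a ≡ y [ i ]≔ᴰ digit a i) → countᴰ Q? ≡ count (λ c → Q? (y [ i ]≔ᴰ c))
countᴰ-line {f = f} Q? (y ∷ ys) zero    line = sum-cong-≗ {f zero} (λ c →
  countᴰ-point (λ a → Q? (c ∷ a)) ys (λ a q → cong tail (line (c ∷ a) q)))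
countᴰ-line {f = f} Q? (y ∷ ys) (suc i) line = begin
  ∑[ c < f zero ] countᴰ (λ a → Q? (c ∷ a))  ≡⟨ ∑-point _ y (λ c c≢y →
    trans (countᴰ-point (λ a → Q? (c ∷ a)) ys (λ a → ⊥-elim ∘ c≢y ∘ cong head ∘ line (c ∷ a)))
          (𝟙-no _ (c≢y ∘ cong head ∘ line (c ∷ ys)))) ⟩
  countᴰ (λ a → Q? (y ∷ a))                  ≡⟨ countᴰ-line (λ a → Q? (y ∷ a)) ys i (λ a q → cong tail (line (y ∷ a) q)) ⟩
  count (λ c → Q? (y ∷ ys [ i ]≔ᴰ c))         ∎
  where open ≡-Reasoning

x∉p-x : ∀ {n} (p : Subset n) x → x ∉ p - x
x∉p-x (_ ∷ p) zero    ()
x∉p-x (_ ∷ p) (suc x) (there x∈p-x) = x∉p-x p x x∈p-x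

x∈p-y⇒x≢y : ∀ {n} {p : Subset n} {x y} → x ∈ p - y → x ≢ y
x∈p-y⇒x≢y {p = p} {x} x∈p-y refl = x∉p-x p x x∈p-y

∣⊤-x∣≡n : ∀ {n} (x : Fin (suc n)) → ∣ ⊤ - x ∣ ≡ n
∣⊤-x∣≡n {n}     zero    = trans (cong (∣_∣ ∘ (outside ∷_)) (p─⊥≡p (⊤ {n}))) (∣⊤∣≡n n)
∣⊤-x∣≡n {suc n} (suc x) = cong suc (∣⊤-x∣≡n x)

∣p∣≡n⇒p≡⊤-x : ∀ {n} (p : Subset (suc n)) → ∣ p ∣ ≡ n → ∃ λ x → p ≡ ⊤ - x
∣p∣≡n⇒p≡⊤-x         (outside ∷ p) ∣p∣≡n = zero , cong (outside ∷_) (trans (∣p∣≡n⇒p≡⊤ ∣p∣≡n) (sym (p─⊥≡p ⊤)))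
∣p∣≡n⇒p≡⊤-x {zero}  (inside ∷ p)  ()
∣p∣≡n⇒p≡⊤-x {suc n} (inside ∷ p)  ∣p∣≡n with ∣p∣≡n⇒p≡⊤-x p (cong ℕ.pred ∣p∣≡n)
... | x , refl = suc x , refl

agrees? : ∀ {N k v} (A : Array N k v) S x → Decidable (Agrees A S x)
agrees? A S x r = all? (λ j → (j ∈? S) →-dec (A r j ≟ x j))

occurrences≡count : ∀ {N k v} (A : Array N k v) S x → occurrences A S x ≡ count (agrees? A S x)
occurrences≡count {N} A S x = length-filter-tabulate (agrees? A S x) N id

_[_]≔_ : ∀ {k v} → Tuple k v → (m : Fin k) → Fin (v m) → Tuple k v
(x [ m ]≔ c) j with j ≟ m
... | yes refl = c
... | no _     = x j

[]≔-same : ∀ {k v} (x : Tuple k v) m c → (x [ m ]≔ c) m ≡ c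
[]≔-same x m c with m ≟ m
... | yes refl = refl
... | no m≢m   = contradiction refl m≢m

[]≔-other : ∀ {k v} (x : Tuple k v) {m j} c → j ≢ m → (x [ m ]≔ c) j ≡ x j
[]≔-other x {m} {j} c j≢m with j ≟ m
... | yes j≡m = contradiction j≡m j≢m
... | no _    = refl

occurrences-marginal : ∀ {N k v} (A : Array N k v) {S m} (x : Tuple k v) → m ∈ S →
                       ∑[ c < v m ] occurrences A S (x [ m ]≔ c) ≡ occurrences A (S - m) x
occurrences-marginal {N} {v = v} A {S} {m} x m∈S = begin
  ∑[ c < v m ] occurrences A S (x [ m ]≔ c)              ≡⟨ sum-cong-≗ {v m} (λ c → occurrences≡count A S _) ⟩
  ∑[ c < v m ] ∑[ r < N ] 𝟙 (agrees? A S (x [ m ]≔ c) r) ≡⟨ ∑-comm (λ c r → 𝟙 (agrees? A S (x [ m ]≔ c) r)) ⟩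
  ∑[ r < N ] ∑[ c < v m ] 𝟙 (agrees? A S (x [ m ]≔ c) r) ≡⟨ sum-cong-≗ {N} fibre ⟩
  ∑[ r < N ] 𝟙 (agrees? A (S - m) x r)                   ≡⟨ occurrences≡count A (S - m) x ⟨
  occurrences A (S - m) x                                ∎
  where
  open ≡-Reasoning
  agrees-at-own-value : ∀ r → Agrees A S (x [ m ]≔ A r m) r ⇔ Agrees A (S - m) x r
  agrees-at-own-value r = mk⇔
    (λ ag j j∈S-m → trans (ag j (p─q⊆p _ _ j∈S-m)) ([]≔-other x _ (x∈p-y⇒x≢y j∈S-m)))
    (λ ag j j∈S → case j ≟ m of λ where
       (yes refl) → sym ([]≔-same x m (A r m))
       (no j≢m)   → trans (ag j (x∈p∧x≢y⇒x∈p-y j∈S j≢m)) (sym ([]≔-other x _ j≢m)))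
  fibre : ∀ r → ∑[ c < v m ] 𝟙 (agrees? A S (x [ m ]≔ c) r) ≡ 𝟙 (agrees? A (S - m) x r)
  fibre r = trans
    (∑-point _ (A r m) (λ c c≢Arm → 𝟙-no _ (λ ag → c≢Arm (sym (trans (ag m m∈S) ([]≔-same x m c))))))
    (𝟙-cong _ _ (agrees-at-own-value r))

occurrences-minus : ∀ {N t k v} (A : Array N k v) {λS} → IsMOAWithIndex N t k v A λS →
                    ∀ {S m} → ∣ S ∣ ≡ t → m ∈ S → ∀ x → occurrences A (S - m) x ≡ v m * λS S
occurrences-minus {v = v} A {λS} moa {S} {m} ∣S∣≡t m∈S x = begin
  occurrences A (S - m) x                    ≡⟨ occurrences-marginal A x m∈S ⟨
  ∑[ c < v m ] occurrences A S (x [ m ]≔ c)  ≡⟨ sum-cong-≗ {v m} (λ c → moa S ∣S∣≡t _) ⟩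
  ∑[ c < v m ] λS S                          ≡⟨ ∑-const (v m) (λS S) ⟩
  v m * λS S                                 ∎
  where open ≡-Reasoning

index-cross : ∀ {N t v} (A : Array N (suc t) v) {λS} → IsMOAWithIndex N t (suc t) v A λS →
              Tuple (suc t) v → ∀ {i j} → i ≢ j → v i * λS (⊤ - j) ≡ v j * λS (⊤ - i)
index-cross {v = v} A {λS} moa x {i} {j} i≢j = begin
  v i * λS (⊤ - j)             ≡⟨ occurrences-minus A moa (∣⊤-x∣≡n j) (x∈p∧x≢y⇒x∈p-y ∈⊤ i≢j) x ⟨
  occurrences A (⊤ - j - i) x  ≡⟨ cong (λ S → occurrences A S x) (p─q─r≡p─r─q ⊤ _ _) ⟩
  occurrences A (⊤ - i - j) x  ≡⟨ occurrences-minus A moa (∣⊤-x∣≡n i) (x∈p∧x≢y⇒x∈p-y ∈⊤ (i≢j ∘ sym)) x ⟩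
  v j * λS (⊤ - i)             ∎
  where open ≡-Reasoning

StrictlyIncreasing : ∀ {n} → (Fin n → ℕ) → Set
StrictlyIncreasing v = ∀ i j → i <ᶠ j → v i < v j

strictlyIncreasing⇒injective : ∀ {n} {v : Fin n → ℕ} → StrictlyIncreasing v → ∀ {i j} → v i ≡ v j → i ≡ j
strictlyIncreasing⇒injective {v = v} incr {i} {j} vi≡vj with <-cmp i j
... | tri< i<j _ _ = contradiction vi≡vj (<⇒≢ (incr i j i<j))
... | tri≈ _ i≡j _ = i≡j
... | tri> _ _ j<i = contradiction (sym vi≡vj) (<⇒≢ (incr j i j<i))

mod≡⇔%≡toℕ : ∀ m {d} .{{_ : NonZero d}} (x : Fin d) → (m mod d ≡ x) ⇔ (m % d ≡ toℕ x)
mod≡⇔%≡toℕ m {d} x = mk⇔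
  (λ eq → trans (sym (toℕ-fromℕ< (m%n<n m d))) (cong toℕ eq))
  (λ eq → toℕ-injective (trans (toℕ-fromℕ< (m%n<n m d)) eq))

zeroTuple : ∀ {k} {v : Fin k → ℕ} → (∀ j → 0 < v j) → Tuple k v
zeroTuple pos j = fromℕ< (pos j)

index-one⇒∣ : ∀ {N t v} (A : Array N (suc t) v) {λS} → IsMOAWithIndex N t (suc t) v A λS →
              Tuple (suc t) v → ∀ {i j} → λS (⊤ - j) ≡ 1 → i ≢ j → v j ∣ v i
index-one⇒∣ {v = v} A {λS} moa x {i} {j} λS≡1 i≢j = subst (v j ∣_) (begin
  v j * λS (⊤ - i)  ≡⟨ index-cross A moa x i≢j ⟨
  v i * λS (⊤ - j)  ≡⟨ cong (v i *_) λS≡1 ⟩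
  v i * 1           ≡⟨ *-identityʳ (v i) ⟩
  v i               ∎) (m∣m*n (λS (⊤ - i)))
  where open ≡-Reasoning

index-one⇒divisibility : ∀ {N t v} (A : Array N (suc t) v) {λS} → IsMOAWithIndex N t (suc t) v A λS →
  (∀ i → 0 < v i) → StrictlyIncreasing v →
  ∃ (λ S → ∣ S ∣ ≡ t × λS S ≡ 1) → ∀ i → v zero ∣ v (suc i)
index-one⇒divisibility {v = v} A moa pos incr (S , ∣S∣≡t , λS≡1) i with ∣p∣≡n⇒p≡⊤-x S ∣S∣≡t
... | zero  , refl = index-one⇒∣ A moa (zeroTuple pos) λS≡1 (λ ())
... | suc j , refl = contradiction (∣⇒≤ {{>-nonZero (pos zero)}} (index-one⇒∣ A moa (zeroTuple pos) λS≡1 (λ ())))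
                                   (<⇒≱ (incr zero (suc j) z<s))

module Construction {t} (v : Fin (suc t) → ℕ) .{{_ : NonZero (v zero)}} where

  row : Digits t (λ i → v (suc i)) → Tuple (suc t) v
  row a zero    = digitSum a mod v zero
  row a (suc i) = digit a i

  array : Array (∏ t (λ i → v (suc i))) (suc t) v
  array r = row (decode r)

  RowAgrees : Subset (suc t) → Tuple (suc t) v → Pred (Digits t (λ i → v (suc i))) 0ℓ
  RowAgrees S x a = ∀ j → j ∈ S → row a j ≡ x j

  rowAgrees? : ∀ S x → Decidable (RowAgrees S x)
  rowAgrees? S x a = all? (λ j → (j ∈? S) →-dec (row a j ≟ x j))

  occurrences-array : ∀ S x → occurrences array S x ≡ countᴰ (rowAgrees? S x)
  occurrences-array S x = trans (occurrences≡count array S x) (∑-decode (λ a → 𝟙 (rowAgrees? S x a)))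

  occurrences-⊤-zero : ∀ x → occurrences array (⊤ - zero) x ≡ 1
  occurrences-⊤-zero x = begin
    occurrences array (⊤ - zero) x    ≡⟨ occurrences-array _ x ⟩
    countᴰ (rowAgrees? (⊤ - zero) x)  ≡⟨ countᴰ-point _ y only-y ⟩
    𝟙 (rowAgrees? (⊤ - zero) x y)     ≡⟨ 𝟙-yes _ y-agrees ⟩
    1                                 ∎
    where
    open ≡-Reasoning
    y : Digits t (λ i → v (suc i))
    y = digits (λ i → x (suc i))
    only-y : ∀ a → RowAgrees (⊤ - zero) x a → a ≡ y
    only-y a ag = digit-injective λ i →
      trans (ag (suc i) (x∈p∧x≢y⇒x∈p-y {y = zero} ∈⊤ (λ ()))) (sym (digit-digits _ i))
    y-agrees : RowAgrees (⊤ - zero) x y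
    y-agrees zero    ()
    y-agrees (suc i) _  = digit-digits _ i

  occurrences-⊤-suc : ∀ i → v zero ∣ v (suc i) → ∀ x →
                      occurrences array (⊤ - suc i) x ≡ v (suc i) / v zero
  occurrences-⊤-suc i v₀∣vᵢ x = begin
    occurrences array (⊤ - suc i) x                       ≡⟨ occurrences-array _ x ⟩
    countᴰ (rowAgrees? (⊤ - suc i) x)                     ≡⟨ countᴰ-line _ y i on-line ⟩
    count (λ c → rowAgrees? (⊤ - suc i) x (y [ i ]≔ᴰ c))  ≡⟨ sum-cong-≗ {v (suc i)} (λ c →
                                                                𝟙-cong _ _ (line-agrees c)) ⟩
    count (λ (c : Fin (v (suc i))) →
             (toℕ c + s) % v zero ℕ.≟ toℕ (x zero))        ≡⟨ count-residue (v zero) v₀∣vᵢ s (x zero) ⟩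
    v (suc i) / v zero                                    ∎
    where
    open ≡-Reasoning
    y : Digits t (λ i → v (suc i))
    y = digits (λ i → x (suc i))
    s : ℕ
    s = proj₁ (digitSum-update y i)
    sum-eq : ∀ c → digitSum (y [ i ]≔ᴰ c) ≡ toℕ c + s
    sum-eq = proj₂ (digitSum-update y i)
    on-line : ∀ a → RowAgrees (⊤ - suc i) x a → a ≡ y [ i ]≔ᴰ digit a i
    on-line a ag = digit-injective λ l → case l ≟ i of λ where
      (yes refl) → sym (digit-update-same y i _)
      (no l≢i)   → trans (ag (suc l) (x∈p∧x≢y⇒x∈p-y {y = suc i} ∈⊤ (l≢i ∘ suc-injective)))
                         (trans (sym (digit-digits _ l)) (sym (digit-update-other y _ l≢i)))
    line-agrees : ∀ c → RowAgrees (⊤ - suc i) x (y [ i ]≔ᴰ c) ⇔ ((toℕ c + s) % v zero ≡ toℕ (x zero))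
    line-agrees c = mk⇔
      (λ ag → subst (λ m → m % v zero ≡ toℕ (x zero)) (sum-eq c)
                    (Equivalence.to (mod≡⇔%≡toℕ _ (x zero)) (ag zero (x∈p∧x≢y⇒x∈p-y {y = suc i} ∈⊤ (λ ())))))
      (λ eq → λ where
        zero    _       → Equivalence.from (mod≡⇔%≡toℕ _ (x zero))
                            (subst (λ m → m % v zero ≡ toℕ (x zero)) (sym (sum-eq c)) eq)
        (suc l) l∈⊤-sucᵢ → trans (digit-update-other y c (x∈p-y⇒x≢y l∈⊤-sucᵢ ∘ cong suc))
                                  (digit-digits _ l))

  occurrences-⊤-j : (∀ i → v zero ∣ v (suc i)) → ∀ j x → occurrences array (⊤ - j) x ≡ v j / v zero
  occurrences-⊤-j dv zero    x = trans (occurrences-⊤-zero x) (sym (n/n≡1 (v zero)))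
  occurrences-⊤-j dv (suc i) x = occurrences-⊤-suc i (dv i) x

  isPDIMOA* : (∀ i → v zero ∣ v (suc i)) → StrictlyIncreasing v → (x₀ : Tuple (suc t) v) →
              IsPDIMOA* (∏ t (λ i → v (suc i))) t (suc t) v array (λ S → occurrences array S x₀)
  isPDIMOA* dv incr x₀ = (isMOA , distinct) , ⊤ - zero , ∣⊤-x∣≡n zero , occurrences-⊤-zero x₀
    where
    v₀∣ : ∀ j → v zero ∣ v j
    v₀∣ zero    = ∣-refl
    v₀∣ (suc i) = dv i
    isMOA : IsMOAWithIndex _ t (suc t) v array (λ S → occurrences array S x₀)
    isMOA S ∣S∣≡t x with ∣p∣≡n⇒p≡⊤-x S ∣S∣≡t
    ... | j , refl = trans (occurrences-⊤-j dv j x) (sym (occurrences-⊤-j dv j x₀))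
    distinct : ∀ S S′ → ∣ S ∣ ≡ t → ∣ S′ ∣ ≡ t → S ≢ S′ →
               occurrences array S x₀ ≢ occurrences array S′ x₀
    distinct S S′ ∣S∣≡t ∣S′∣≡t S≢S′ eq with ∣p∣≡n⇒p≡⊤-x S ∣S∣≡t | ∣p∣≡n⇒p≡⊤-x S′ ∣S′∣≡t
    ... | j , refl | j′ , refl = S≢S′ (cong (⊤ -_) (strictlyIncreasing⇒injective incr
      (/-cancelʳ-≡ (v₀∣ j) (v₀∣ j′) (begin
        v j / v zero                   ≡⟨ occurrences-⊤-j dv j x₀ ⟨
        occurrences array (⊤ - j) x₀   ≡⟨ eq ⟩
        occurrences array (⊤ - j′) x₀  ≡⟨ occurrences-⊤-j dv j′ x₀ ⟩
        v j′ / v zero                  ∎))))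
      where open ≡-Reasoning

theorem4p16 : (t : ℕ) → 0 < t → (v : Fin (suc t) → ℕ) →
              (∀ i → 0 < v i) → (∀ i j → i <ᶠ j → v i < v j) →
              PDIMOA*-exists (∏ t (λ i → v (suc i))) t (suc t) v
                ⇔ (∀ (i : Fin t) → v zero ∣ v (suc i))
theorem4p16 t _ v pos incr = mk⇔
  (λ (A , _ , (moa , _) , index-one) → index-one⇒divisibility A moa pos incr index-one)
  (λ dv → array , _ , isPDIMOA* dv incr (zeroTuple pos))
  where open Construction v {{>-nonZero (pos zero)}}
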